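{- Let $m$ and $r$ be non-negative integers. If $\{(s_k),(\sigma_k)\}$, $k=0,1,2,\ldots$, is a binomial-transform pair of the first kind, then so is the pair of sequences \[ a_k=\sum_{p=0}^r(-1)^p\binom rp s_{k+p+m},\qquad \alpha_k=\sum_{p=0}^m(-1)^p\binom mp\sigma_{k+p+r},\qquad k=0,1,2,\ldots; \] thus, for every non-negative integer $n$, \[ \sum_{k=0}^n(-1)^k\binom nk\sum_{p=0}^r(-1)^p\binom rp s_{k+p+m}=\sum_{k=0}^m(-1)^k\binom mk\sigma_{n+k+r}. \]
   Context: Two sequences $(s_k)_{k\ge0}$ and $(\sigma_k)_{k\ge0}$ of complex numbers form a binomial-transform pair of the first kind if $\sigma_n=\sum_{k=0}^n(-1)^k\binom nk s_k$ for every non-negative integer $n$. -}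

module Defs where

open import Level using (Level)
open import Data.Nat using (ℕ; zero; suc) renaming (_+_ to _+ℕ_)
open import Data.Nat.Combinatorics using (_C_)
open import Algebra.Bundles using (CommutativeRing)

-- Everything is parametrised by a commutative ring R (the paper uses ℂ,
-- which is not available in agda-stdlib).
module _ {c ℓ : Level} (R : CommutativeRing c ℓ) where
  open CommutativeRing R

  ℕ→R : ℕ → Carrier
  ℕ→R zero    = 0#
  ℕ→R (suc n) = 1# + ℕ→R n

  neg1^ : ℕ → Carrier
  neg1^ zero    = 1#
  neg1^ (suc k) = (- 1#) * neg1^ k

  Σ0to : ℕ → (ℕ → Carrier) → Carrier
  Σ0to zero    f = f 0
  Σ0to (suc n) f = Σ0to n f + f (suc n)

  binomT : (ℕ → Carrier) → ℕ → Carrier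
  binomT s n = Σ0to n (λ k → neg1^ k * (ℕ→R (n C k) * s k))

  BinomialPair₁ : (ℕ → Carrier) → (ℕ → Carrier) → Set ℓ
  BinomialPair₁ s σ = ∀ n → σ n ≈ binomT s n

  seqA : ℕ → ℕ → (ℕ → Carrier) → ℕ → Carrier
  seqA m r s k = Σ0to r (λ p → neg1^ p * (ℕ→R (r C p) * s (k +ℕ p +ℕ m)))

  seqα : ℕ → ℕ → (ℕ → Carrier) → ℕ → Carrier
  seqα m r σ k = Σ0to m (λ p → neg1^ p * (ℕ→R (m C p) * σ (k +ℕ p +ℕ r)))

{-# OPTIONS --safe #-}
module Submission where

-- With the difference operator (Δ s) k = s k − s (k + 1), Pascal's rule turns the
-- binomial transform into iterated differences: Σ_j (−1)^j C(n,j) s_{k+j} = (Δⁿ s)_k.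
-- So σ_n = (Δⁿ s)_0, and a_k = (Δʳ s)_{k+m} gives Σ_k (−1)^k C(n,k) a_k = (Δⁿ⁺ʳ s)_m.
-- On the other side α_n = Σ_p (−1)^p C(m,p) (Δᵖ t)_0 with t = Δⁿ⁺ʳ s, and this
-- equals t_m: the binomial transform is an involution.

open import Defs
open import Level using (Level)
open import Data.Nat using (ℕ; zero; suc) renaming (_+_ to _+ℕ_)
open import Algebra.Bundles using (CommutativeRing)
open import Data.Nat.Combinatorics using (_C_; nCk+nC[k+1]≡[n+1]C[k+1]; k>n⇒nCk≡0)
import Data.Nat.Properties as ℕ
open import Relation.Binary.PropositionalEquality as ≡ using (_≡_; cong)
import Relation.Binary.Reasoning.Setoid as SetoidReasoning

module BinomialTransform {c ℓ : Level} (R : CommutativeRing c ℓ) where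
  open CommutativeRing R
  open SetoidReasoning setoid
  open import Algebra.Properties.Ring ring using (-1*x≈-x; -‿distribˡ-*)
  open import Algebra.Properties.AbelianGroup +-abelianGroup
    using (⁻¹-∙-comm; ⁻¹-anti-homo‿-; xyx⁻¹≈y)
  open import Algebra.Properties.CommutativeSemigroup +-commutativeSemigroup
    using (interchange)

  Σ0to-cong : ∀ n {f g : ℕ → Carrier} → (∀ k → f k ≈ g k) → Σ0to R n f ≈ Σ0to R n g
  Σ0to-cong zero    f≈g = f≈g 0
  Σ0to-cong (suc n) f≈g = +-cong (Σ0to-cong n f≈g) (f≈g (suc n))

  Σ0to-distrib-minus : ∀ n (f g : ℕ → Carrier) →
                       Σ0to R n (λ k → f k - g k) ≈ Σ0to R n f - Σ0to R n g
  Σ0to-distrib-minus zero    f g = refl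
  Σ0to-distrib-minus (suc n) f g = begin
    Σ0to R n (λ k → f k - g k) + (f (suc n) - g (suc n))
      ≈⟨ +-congʳ (Σ0to-distrib-minus n f g) ⟩
    (Σ0to R n f - Σ0to R n g) + (f (suc n) - g (suc n))
      ≈⟨ interchange _ _ _ _ ⟩
    (Σ0to R n f + f (suc n)) + (- Σ0to R n g - g (suc n))
      ≈⟨ +-congˡ (⁻¹-∙-comm _ _) ⟩
    (Σ0to R n f + f (suc n)) - (Σ0to R n g + g (suc n)) ∎

  Σ0to-head : ∀ n (f : ℕ → Carrier) → Σ0to R (suc n) f ≈ f 0 + Σ0to R n (λ k → f (suc k))
  Σ0to-head zero    f = refl
  Σ0to-head (suc n) f = trans (+-congʳ (Σ0to-head n f)) (+-assoc _ _ _)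

  ℕ→R-homo-+ : ∀ a b → ℕ→R R (a +ℕ b) ≈ ℕ→R R a + ℕ→R R b
  ℕ→R-homo-+ zero    b = sym (+-identityˡ _)
  ℕ→R-homo-+ (suc a) b = trans (+-congˡ (ℕ→R-homo-+ a b)) (sym (+-assoc _ _ _))

  binomT-cong : ∀ n {s t : ℕ → Carrier} → (∀ k → s k ≈ t k) → binomT R s n ≈ binomT R t n
  binomT-cong n s≈t = Σ0to-cong n (λ k → *-congˡ (*-congˡ (s≈t k)))

  binomT-zero : ∀ s → binomT R s 0 ≈ s 0
  binomT-zero s = trans (*-identityˡ _) (trans (*-congʳ (+-identityʳ 1#)) (*-identityˡ _))

  binomT-suc : ∀ n s → binomT R s (suc n) ≈ binomT R s n - binomT R (λ k → s (suc k)) n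
  binomT-suc n s = begin
    binomT R s (suc n)
      ≈⟨ Σ0to-head n _ ⟩
    term n s 0 + Σ0to R n (λ k → term (suc n) s (suc k))
      ≈⟨ +-congˡ (Σ0to-cong n pascal) ⟩
    term n s 0 + Σ0to R n (λ k → term n s (suc k) - term n s′ k)
      ≈⟨ +-congˡ (Σ0to-distrib-minus n _ _) ⟩
    term n s 0 + (Σ0to R n (λ k → term n s (suc k)) - binomT R s′ n)
      ≈⟨ sym (+-assoc _ _ _) ⟩
    (term n s 0 + Σ0to R n (λ k → term n s (suc k))) - binomT R s′ n
      ≈⟨ +-congʳ (sym (Σ0to-head n (term n s))) ⟩
    (binomT R s n + term n s (suc n)) - binomT R s′ n
      ≈⟨ +-congʳ (trans (+-congˡ last-term-vanishes) (+-identityʳ _)) ⟩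
    binomT R s n - binomT R s′ n ∎
    where
    term : ℕ → (ℕ → Carrier) → ℕ → Carrier
    term j f k = neg1^ R k * (ℕ→R R (j C k) * f k)

    s′ : ℕ → Carrier
    s′ k = s (suc k)

    pascal : ∀ k → term (suc n) s (suc k) ≈ term n s (suc k) - term n s′ k
    pascal k = begin
      - 1# * e * (ℕ→R R (suc n C suc k) * x)
        ≡⟨ cong (λ b → - 1# * e * (ℕ→R R b * x)) (≡.sym (nCk+nC[k+1]≡[n+1]C[k+1] n k)) ⟩
      - 1# * e * (ℕ→R R (n C k +ℕ n C suc k) * x)
        ≈⟨ *-congˡ (*-congʳ (ℕ→R-homo-+ (n C k) (n C suc k))) ⟩
      - 1# * e * ((ℕ→R R (n C k) + ℕ→R R (n C suc k)) * x)
        ≈⟨ *-congˡ (trans (distribʳ _ _ _) (+-comm _ _)) ⟩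
      - 1# * e * (ℕ→R R (n C suc k) * x + ℕ→R R (n C k) * x)
        ≈⟨ distribˡ _ _ _ ⟩
      term n s (suc k) + - 1# * e * (ℕ→R R (n C k) * x)
        ≈⟨ +-congˡ (trans (*-congʳ (-1*x≈-x e)) (sym (-‿distribˡ-* _ _))) ⟩
      term n s (suc k) - term n s′ k ∎
      where
      e x : Carrier
      e = neg1^ R k
      x = s (suc k)

    last-term-vanishes : term n s (suc n) ≈ 0#
    last-term-vanishes = begin
      neg1^ R (suc n) * (ℕ→R R (n C suc n) * s (suc n))
        ≡⟨ cong (λ b → neg1^ R (suc n) * (ℕ→R R b * s (suc n))) (k>n⇒nCk≡0 (ℕ.n<1+n n)) ⟩
      neg1^ R (suc n) * (0# * s (suc n))
        ≈⟨ trans (*-congˡ (zeroˡ _)) (zeroʳ _) ⟩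
      0# ∎

  -- Minus the usual forward difference: with this sign binomT s n is exactly Δ^ n s 0.
  Δ : (ℕ → Carrier) → ℕ → Carrier
  Δ s k = s k - s (suc k)

  Δ^ : ℕ → (ℕ → Carrier) → ℕ → Carrier
  Δ^ zero    s = s
  Δ^ (suc n) s = Δ (Δ^ n s)

  Δ-cong : ∀ {s t} → (∀ k → s k ≈ t k) → ∀ k → Δ s k ≈ Δ t k
  Δ-cong s≈t k = +-cong (s≈t k) (-‿cong (s≈t (suc k)))

  Δ-Δ^-comm : ∀ n s k → Δ (Δ^ n s) k ≈ Δ^ n (Δ s) k
  Δ-Δ^-comm zero    s k = refl
  Δ-Δ^-comm (suc n) s k = Δ-cong (Δ-Δ^-comm n s) k

  Δ^-+ : ∀ m n s k → Δ^ (m +ℕ n) s k ≈ Δ^ m (Δ^ n s) k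
  Δ^-+ zero    n s k = refl
  Δ^-+ (suc m) n s k = Δ-cong (Δ^-+ m n s) k

  Δ^-shift : ∀ n m s k → Δ^ n (λ i → s (i +ℕ m)) k ≈ Δ^ n s (k +ℕ m)
  Δ^-shift zero    m s k = refl
  Δ^-shift (suc n) m s k = +-cong (Δ^-shift n m s k) (-‿cong (Δ^-shift n m s (suc k)))

  binomT≈Δ^ : ∀ n s k → binomT R (λ j → s (k +ℕ j)) n ≈ Δ^ n s k
  binomT≈Δ^ zero    s k =
    trans (binomT-zero (λ j → s (k +ℕ j))) (reflexive (cong s (ℕ.+-identityʳ k)))
  binomT≈Δ^ (suc n) s k = begin
    binomT R (λ j → s (k +ℕ j)) (suc n)
      ≈⟨ binomT-suc n _ ⟩
    binomT R (λ j → s (k +ℕ j)) n - binomT R (λ j → s (k +ℕ suc j)) n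
      ≈⟨ +-congˡ (-‿cong (binomT-cong n (λ j → reflexive (cong s (ℕ.+-suc k j))))) ⟩
    binomT R (λ j → s (k +ℕ j)) n - binomT R (λ j → s (suc k +ℕ j)) n
      ≈⟨ +-cong (binomT≈Δ^ n s k) (-‿cong (binomT≈Δ^ n s (suc k))) ⟩
    Δ^ (suc n) s k ∎

  binomT-inversion : ∀ m t → binomT R (λ p → Δ^ p t 0) m ≈ t m
  binomT-inversion zero    t = binomT-zero (λ p → Δ^ p t 0)
  binomT-inversion (suc m) t = begin
    binomT R (λ p → Δ^ p t 0) (suc m)
      ≈⟨ binomT-suc m _ ⟩
    binomT R (λ p → Δ^ p t 0) m - binomT R (λ p → Δ (Δ^ p t) 0) m
      ≈⟨ +-congˡ (-‿cong (binomT-cong m (λ p → Δ-Δ^-comm p t 0))) ⟩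
    binomT R (λ p → Δ^ p t 0) m - binomT R (λ p → Δ^ p (Δ t) 0) m
      ≈⟨ +-cong (binomT-inversion m t) (-‿cong (binomT-inversion m (Δ t))) ⟩
    t m - (t m - t (suc m))
      ≈⟨ +-congˡ (⁻¹-anti-homo‿- _ _) ⟩
    t m + (t (suc m) - t m)
      ≈⟨ trans (sym (+-assoc _ _ _)) (xyx⁻¹≈y _ _) ⟩
    t (suc m) ∎

  BinomialPair₁⇒Δ^ : ∀ {s σ} → BinomialPair₁ R s σ → ∀ n → σ n ≈ Δ^ n s 0
  BinomialPair₁⇒Δ^ {s} pair n = trans (pair n) (binomT≈Δ^ n s 0)

theorem12 : {c ℓ : Level} (R : CommutativeRing c ℓ) (m r : ℕ)
    (s σ : ℕ → CommutativeRing.Carrier R) →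
    BinomialPair₁ R s σ →
    BinomialPair₁ R (seqA R m r s) (seqα R m r σ)
theorem12 R m r s σ pair n = begin
  seqα R m r σ n
    ≈⟨ binomT-cong m σ-shifted ⟩
  binomT R (λ p → Δ^ p (Δ^ (n +ℕ r) s) 0) m
    ≈⟨ binomT-inversion m _ ⟩
  Δ^ (n +ℕ r) s m
    ≈⟨ sym (Δ^-shift (n +ℕ r) m s 0) ⟩
  Δ^ (n +ℕ r) s′ 0
    ≈⟨ Δ^-+ n r s′ 0 ⟩
  Δ^ n (Δ^ r s′) 0
    ≈⟨ sym (binomT≈Δ^ n _ 0) ⟩
  binomT R (Δ^ r s′) n
    ≈⟨ binomT-cong n (λ k → sym (binomT≈Δ^ r s′ k)) ⟩
  binomT R (seqA R m r s) n ∎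
  where
  open CommutativeRing R
  open SetoidReasoning setoid
  open BinomialTransform R

  s′ : ℕ → Carrier
  s′ i = s (i +ℕ m)

  σ-shifted : ∀ p → σ (n +ℕ p +ℕ r) ≈ Δ^ p (Δ^ (n +ℕ r) s) 0
  σ-shifted p = begin
    σ (n +ℕ p +ℕ r)          ≈⟨ BinomialPair₁⇒Δ^ pair _ ⟩
    Δ^ (n +ℕ p +ℕ r) s 0     ≡⟨ cong (λ j → Δ^ j s 0) reorder ⟩
    Δ^ (p +ℕ (n +ℕ r)) s 0   ≈⟨ Δ^-+ p (n +ℕ r) s 0 ⟩
    Δ^ p (Δ^ (n +ℕ r) s) 0   ∎
    where
    reorder : n +ℕ p +ℕ r ≡ p +ℕ (n +ℕ r)
    reorder = ≡.trans (cong (_+ℕ r) (ℕ.+-comm n p)) (ℕ.+-assoc p n r)
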